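{- Let $\Sigma\cup\{x|_p y\}$ be a finite set of approximate exclusion atoms with $|x|=|y|=n$ and $p<\frac12$. Then the problem of deciding whether $\Sigma\vdash x|_p y$ is decidable.
   Context: Finite tuples of variables (repetitions allowed) are written $x,y,u,v,\dots$; $|x|$ is the length, juxtaposition denotes concatenation. For a real $0\le p\le1$, an approximate exclusion atom is an expression $x|_p y$ with $|x|=|y|$ (semantically, a team $T$, i.e. a finite set of assignments, satisfies it iff removing at most $p\cdot|T|$ assignments yields a team $T''$ with $s_1(x)\neq s_2(y)$ for all $s_1,s_2\in T''$). Rules (schemata over tuples making atoms well formed): (A1) $x|_p x\vdash y|_0 z$ for $p<1$; (A2) $x|_p y\vdash y|_p x$; (A3) $x|_p y\vdash xu|_p yv$; (A4) $xuu|_p yvv\vdash xu|_p yv$; (A5) $xyz|_p uvw\vdash xzy|_p uwv$ where $|x|=|u|$, $|y|=|v|$; (A6) $xw|_p yw\vdash zz|_p xy$; (A7) $x|_q y\vdash x|_p y$ for $q\le p\le 1$; (A8) $\vdash x|_1 y$. $\Sigma\vdash\varphi$ means $\varphi$ is derivable from atoms of $\Sigma$ by finitely many applications of these rules.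
   Formalization: The degree p of every approximate exclusion atom, in Σ, in the target atom and in derivations, is rational rather than real. -}

module Defs where

open import Data.Nat using (ℕ)
open import Data.List using (List; _++_; length)
open import Data.List.Membership.Propositional using (_∈_)
open import Data.Rational using (ℚ; 0ℚ; 1ℚ; _≤_; _<_)
open import Data.Product using (_×_)
open import Relation.Binary.PropositionalEquality using (_≡_)

Var : Set
Var = ℕ

Tuple : Set
Tuple = List Var

record Atom : Set where
  constructor _∣[_]_
  field
    lhs : Tuple
    prob : ℚ
    rhs : Tuple
open Atom public

WellFormed : Atom → Set
WellFormed (x ∣[ p ] y) = (length x ≡ length y) × (0ℚ ≤ p) × (p ≤ 1ℚ)

-- Σ ⊢ φ : derivability by the rules (A1)-(A8), with side conditions
-- ensuring every atom occurring in a rule instance is well formed.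
infix 4 _⊢_
data _⊢_ (Σ : List Atom) : Atom → Set where
  hyp : ∀ {φ} → φ ∈ Σ → Σ ⊢ φ
  A1  : ∀ {x y z p} → p < 1ℚ → length y ≡ length z →
        Σ ⊢ (x ∣[ p ] x) → Σ ⊢ (y ∣[ 0ℚ ] z)
  A2  : ∀ {x y p} → Σ ⊢ (x ∣[ p ] y) → Σ ⊢ (y ∣[ p ] x)
  A3  : ∀ {x y u v p} → length u ≡ length v →
        Σ ⊢ (x ∣[ p ] y) → Σ ⊢ ((x ++ u) ∣[ p ] (y ++ v))
  A4  : ∀ {x y u v p} → length x ≡ length y → length u ≡ length v →
        Σ ⊢ ((x ++ u ++ u) ∣[ p ] (y ++ v ++ v)) →
        Σ ⊢ ((x ++ u) ∣[ p ] (y ++ v))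
  A5  : ∀ {x y z u v w p} → length x ≡ length u → length y ≡ length v →
        length z ≡ length w →
        Σ ⊢ ((x ++ y ++ z) ∣[ p ] (u ++ v ++ w)) →
        Σ ⊢ ((x ++ z ++ y) ∣[ p ] (u ++ w ++ v))
  A6  : ∀ {x y z w p} → length x ≡ length y → length z ≡ length x →
        Σ ⊢ ((x ++ w) ∣[ p ] (y ++ w)) →
        Σ ⊢ ((z ++ z) ∣[ p ] (x ++ y))
  A7  : ∀ {x y q p} → q ≤ p → p ≤ 1ℚ →
        Σ ⊢ (x ∣[ q ] y) → Σ ⊢ (x ∣[ p ] y)
  A8  : ∀ {x y} → length x ≡ length y → Σ ⊢ (x ∣[ 1ℚ ] y)

-- An atom matters to the calculus only through its set of columns (x_i, y_i): (A3)-(A5) let an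
-- atom be weakened to any atom whose column set is larger, (A2) swaps every column, and (A6)
-- trades covered columns (x_i, y_i) for columns (z_i, x_i), (z_i, y_i) while dropping diagonal
-- ones. For p < 1, Σ ⊢ x |_p y therefore holds iff either the empty column set is reachable by
-- such steps from the hypotheses of probability below 1 (then (A1) and (A7) derive every atom),
-- or the columns of x |_p y are reachable from the hypotheses of probability at most p. Renaming
-- variables into the finite set V of variables of Σ, x and y maps steps to steps, so it suffices
-- to search the finitely many subsets of V × V, which a saturation does. The bound p < 1/2 is only
-- used as p < 1.
module Submission where

open import Defs

open import Level using (0ℓ)
open import Function using (id; _∘_)
open import Function.Bundles using (_⇔_; mk⇔)
open import Data.Empty using (⊥-elim)
import Data.Nat as ℕ
open import Data.Nat.Properties using (suc-injective)
open import Data.Nat.Induction using (<-wellFounded)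
open import Data.Rational using (ℚ; 0ℚ; 1ℚ; ½; _≤_; _<_)
import Data.Rational.Properties as ℚ
open import Data.Product using (_×_; _,_; proj₁; proj₂; ∃-syntax; swap)
import Data.Product as Product
open import Data.Product.Properties using (≡-dec)
open import Data.Sum using (_⊎_; inj₁; inj₂)
import Data.Sum as Sum
open import Data.List
  using (List; []; _∷_; _++_; [_]; length; map; filter; zip; unzip; concatMap; cartesianProduct)
open import Data.List.Properties
  using (filter-notAll; map-id-local; ++-assoc; unzipWith-++; unzip-swap; unzip-zip;
         length-unzipWith₁; length-unzipWith₂)
  renaming (≡-dec to ≡-dec-List)
open import Data.List.Relation.Unary.Any as Any using (Any; here; there)
open import Data.List.Relation.Unary.All as All using (All; []; _∷_)
import Data.List.Relation.Unary.All.Properties as All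
open import Data.List.Membership.Propositional using (_∈_; find; lose)
open import Data.List.Membership.Propositional.Properties
  using (∈-concatMap⁺; ∈-∃++; ∈-filter⁺; ∈-filter⁻; ∈-++⁺ˡ; ∈-++⁺ʳ; ∈-++⁻; ∈-map⁺; ∈-map⁻;
         ∈-cartesianProduct⁺; ∈-cartesianProduct⁻)
open import Data.List.Relation.Binary.Subset.Propositional using (_⊆_)
open import Data.List.Relation.Binary.Subset.Propositional.Properties
  using (map⁺; All-resp-⊇; ∈-∷⁺ʳ; ++⁺ʳ; xs⊆x∷xs; ⊆-reflexive-↭)
open import Data.List.Relation.Binary.Permutation.Propositional.Properties using (++-comm)
open import Induction.WellFounded using (Acc; acc)
open import Relation.Binary using (Rel; Decidable; DecidableEquality)
open import Relation.Binary.Bundles using (DecTotalOrder)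
open import Relation.Binary.PropositionalEquality using (_≡_; refl; sym; trans; cong; cong₂; subst)
open import Relation.Nullary using (Dec; yes; no; ¬?; contradiction)
open import Relation.Nullary.Decidable as Dec using (map′; _×-dec_; _⊎-dec_; from-yes)
import Relation.Unary as U

-- Reachability in a finite universe

data Reachable {A : Set} (R : Rel A 0ℓ) (H : List A) : A → Set where
  seed : ∀ {a} → a ∈ H → Reachable R H a
  step : ∀ {a b} → Reachable R H a → R a b → Reachable R H b

Reachable-simulate : ∀ {A B : Set} {R : Rel A 0ℓ} {S : Rel B 0ℓ} {H : List A} {G : List B}
                     (f : A → B) → (∀ {h} → h ∈ H → Reachable S G (f h)) →
                     (∀ {a b} → R a b → S (f a) (f b)) →
                     ∀ {a} → Reachable R H a → Reachable S G (f a)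
Reachable-simulate f seeds steps (seed h∈H) = seeds h∈H
Reachable-simulate f seeds steps (step r a→b) = step (Reachable-simulate f seeds steps r) (steps a→b)

module FiniteReachability {A : Set} (_≟_ : DecidableEquality A)
                          {R : Rel A 0ℓ} (R? : Decidable R) (U : List A) where

  open import Data.List.Membership.DecPropositional _≟_ using (_∈?_)

  infix 4 _⟶_
  _⟶_ : Rel A 0ℓ
  a ⟶ b = R a b × b ∈ U

  record Saturation (H : List A) : Set where
    field
      reached           : List A
      reached-reachable : ∀ {a} → a ∈ reached → Reachable _⟶_ H a
      seeds-reached     : H ⊆ reached
      reached-closed    : ∀ {a b} → a ∈ reached → a ⟶ b → b ∈ reached

    reachable⇒reached : ∀ {a} → Reachable _⟶_ H a → a ∈ reached
    reachable⇒reached (seed a∈H)   = seeds-reached a∈H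
    reachable⇒reached (step r a⟶b) = reached-closed (reachable⇒reached r) a⟶b

  Successor : List A → A → Set
  Successor S b = Any (λ a → R a b) S

  successor? : ∀ S b → Dec (Successor S b)
  successor? S b = Any.any? (λ a → R? a b) S

  module _ (H : List A) where

    -- Invariant: S is reached, T holds the rest of U; each round moves the successors of S
    -- from T to S, so the round ends either with S closed or with T shorter.
    saturateFrom : (S T : List A) → Acc ℕ._<_ (length T) →
                   (∀ {a} → a ∈ S → Reachable _⟶_ H a) → H ⊆ S → T ⊆ U →
                   (∀ {b} → b ∈ U → b ∈ S ⊎ b ∈ T) → Saturation H
    saturateFrom S T (acc rec) S-reachable H⊆S T⊆U U⊆S∪T with Any.any? (successor? S) T
    ... | no none = record
      { reached = S ; reached-reachable = S-reachable ; seeds-reached = H⊆S ; reached-closed = closed }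
      where
        closed : ∀ {a b} → a ∈ S → a ⟶ b → b ∈ S
        closed a∈S (Rab , b∈U) with U⊆S∪T b∈U
        ... | inj₁ b∈S = b∈S
        ... | inj₂ b∈T = ⊥-elim (none (lose b∈T (lose a∈S Rab)))
    ... | yes some =
      saturateFrom (new ++ S) rest (rec shrinks) reachable (∈-++⁺ʳ new ∘ H⊆S)
                   (T⊆U ∘ proj₁ ∘ ∈-filter⁻ (¬? ∘ successor? S)) split
      where
        new rest : List A
        new  = filter (successor? S) T
        rest = filter (¬? ∘ successor? S) T

        shrinks : length rest ℕ.< length T
        shrinks = filter-notAll (¬? ∘ successor? S) T (Any.map (λ s ¬s → ¬s s) some)

        reachable : ∀ {a} → a ∈ new ++ S → Reachable _⟶_ H a
        reachable a∈ with ∈-++⁻ new a∈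
        ... | inj₂ a∈S = S-reachable a∈S
        ... | inj₁ a∈new with ∈-filter⁻ (successor? S) a∈new
        ...   | a∈T , s with find s
        ...     | _ , a′∈S , Ra′a = step (S-reachable a′∈S) (Ra′a , T⊆U a∈T)

        split : ∀ {b} → b ∈ U → b ∈ new ++ S ⊎ b ∈ rest
        split b∈U with U⊆S∪T b∈U
        ... | inj₁ b∈S = inj₁ (∈-++⁺ʳ new b∈S)
        ... | inj₂ b∈T with successor? S _
        ...   | yes s = inj₁ (∈-++⁺ˡ (∈-filter⁺ (successor? S) b∈T s))
        ...   | no ¬s = inj₂ (∈-filter⁺ (¬? ∘ successor? S) b∈T ¬s)

  saturate : ∀ H → Saturation H
  saturate H = saturateFrom H H U (<-wellFounded (length U)) seed id id inj₂

  reachable? : ∀ H b → Dec (Reachable _⟶_ H b)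
  reachable? H b = map′ reached-reachable reachable⇒reached (b ∈? reached)
    where open Saturation (saturate H)

-- Column sets and steps

Column : Set
Column = Var × Var

Columns : Set
Columns = List Column

columns : Atom → Columns
columns φ = zip (lhs φ) (rhs φ)

Diagonal : Column → Set
Diagonal c = proj₁ c ≡ proj₂ c

CoveredBy : Columns → Column → Set
CoveredBy E c = ∃[ z ] (z , proj₁ c) ∈ E × (z , proj₂ c) ∈ E

-- flip is (A2), extend subsumes (A3)-(A5), cover is (A6), and (A1) is a cover by diagonals.
data Step (D E : Columns) : Set where
  flip   : map swap D ⊆ E → Step D E
  extend : D ⊆ E → Step D E
  cover  : All (λ c → Diagonal c ⊎ CoveredBy E c) D → Step D E

_≟ᶜ_ : DecidableEquality Column
_≟ᶜ_ = ≡-dec ℕ._≟_ ℕ._≟_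

open import Data.List.Membership.DecPropositional _≟ᶜ_ using () renaming (_∈?_ to _∈ᶜ?_)
open import Data.List.Relation.Binary.Subset.DecPropositional _≟ᶜ_ using (_⊆?_)

coveredBy? : ∀ E c → Dec (CoveredBy E c)
coveredBy? E (a , b) =
  map′ (λ w → let z , _ , z∈ = find w in z , z∈)
       (λ (z , za∈E , zb∈E) → lose (∈-map⁺ proj₁ za∈E) (za∈E , zb∈E))
       (Any.any? (λ z → ((z , a) ∈ᶜ? E) ×-dec ((z , b) ∈ᶜ? E)) (map proj₁ E))

step? : Decidable Step
step? D E with map swap D ⊆? E | D ⊆? E | All.all? (λ c → (proj₁ c ℕ.≟ proj₂ c) ⊎-dec coveredBy? E c) D
... | yes s | _     | _     = yes (flip s)
... | no _  | yes s | _     = yes (extend s)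
... | no _  | no _  | yes s = yes (cover s)
... | no ¬f | no ¬e | no ¬c = no λ { (flip s) → ¬f s ; (extend s) → ¬e s ; (cover s) → ¬c s }

CoveredBy-mono : ∀ {E E′ c} → E ⊆ E′ → CoveredBy E c → CoveredBy E′ c
CoveredBy-mono E⊆E′ (z , za∈E , zb∈E) = z , E⊆E′ za∈E , E⊆E′ zb∈E

Step-mono : ∀ {D D′ E E′} → D′ ⊆ D → E ⊆ E′ → Step D E → Step D′ E′
Step-mono D′⊆D E⊆E′ (flip s)   = flip (λ c∈ → E⊆E′ (s (map⁺ swap D′⊆D c∈)))
Step-mono D′⊆D E⊆E′ (extend s) = extend (λ c∈ → E⊆E′ (s (D′⊆D c∈)))
Step-mono D′⊆D E⊆E′ (cover s)  = cover (All.map (Sum.map₂ (CoveredBy-mono E⊆E′)) (All-resp-⊇ D′⊆D s))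

rename : (Var → Var) → Columns → Columns
rename f = map (Product.map f f)

Step-rename : ∀ f {D E} → Step D E → Step (rename f D) (rename f E)
Step-rename f (flip s)   = flip flipped
  where
    flipped : map swap (rename f _) ⊆ rename f _
    flipped c∈ with ∈-map⁻ swap c∈
    ... | _ , c∈′ , refl with ∈-map⁻ (Product.map f f) c∈′
    ...   | d , d∈D , refl = ∈-map⁺ (Product.map f f) (s (∈-map⁺ swap d∈D))
Step-rename f (extend s) = extend (map⁺ (Product.map f f) s)
Step-rename f (cover s)  = cover (All.map⁺ (All.map renamed s))
  where
    renamed : ∀ {E c} → Diagonal c ⊎ CoveredBy E c →
              Diagonal (Product.map f f c) ⊎ CoveredBy (rename f E) (Product.map f f c)
    renamed (inj₁ eq)                = inj₁ (cong f eq)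
    renamed (inj₂ (z , za∈E , zb∈E)) =
      inj₂ (f z , ∈-map⁺ (Product.map f f) za∈E , ∈-map⁺ (Product.map f f) zb∈E)

sublists : ∀ {A : Set} → List A → List (List A)
sublists []       = [ [] ]
sublists (x ∷ xs) = map (x ∷_) (sublists xs) ++ sublists xs

filter∈sublists : ∀ {A : Set} {P : A → Set} (P? : U.Decidable P) xs → filter P? xs ∈ sublists xs
filter∈sublists P? []       = here refl
filter∈sublists P? (x ∷ xs) with P? x
... | yes _ = ∈-++⁺ˡ (∈-map⁺ (x ∷_) (filter∈sublists P? xs))
... | no _  = ∈-++⁺ʳ (map (x ∷_) (sublists xs)) (filter∈sublists P? xs)

infix 10 _²
_² : List Var → Columns
V ² = cartesianProduct V V

module ColumnReachability (v₀ : Var) (vs : List Var) where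

  open import Data.List.Membership.DecPropositional ℕ._≟_ using () renaming (_∈?_ to _∈ⱽ?_)

  V : List Var
  V = v₀ ∷ vs

  -- Renaming along a retraction onto V preserves steps and moves the fresh variables of covers into V.
  retract : Var → Var
  retract v with v ∈ⱽ? V
  ... | yes _ = v
  ... | no _  = v₀

  retract-∈ : ∀ v → retract v ∈ V
  retract-∈ v with v ∈ⱽ? V
  ... | yes v∈V = v∈V
  ... | no _    = here refl

  retract-fix : ∀ {v} → v ∈ V → retract v ≡ v
  retract-fix {v} v∈V with v ∈ⱽ? V
  ... | yes _   = refl
  ... | no v∉V = ⊥-elim (v∉V v∈V)

  rename-retract-⊆² : ∀ E → rename retract E ⊆ V ²
  rename-retract-⊆² E c∈ with ∈-map⁻ (Product.map retract retract) c∈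
  ... | (a , b) , _ , refl = ∈-cartesianProduct⁺ (retract-∈ a) (retract-∈ b)

  rename-retract-fix : ∀ {E} → E ⊆ V ² → rename retract E ≡ E
  rename-retract-fix E⊆V² = map-id-local (All.tabulate fixed)
    where
      fixed : ∀ {c} → c ∈ _ → Product.map retract retract c ≡ c
      fixed c∈E with ∈-cartesianProduct⁻ V V (E⊆V² c∈E)
      ... | a∈V , b∈V = cong₂ _,_ (retract-fix a∈V) (retract-fix b∈V)

  restrict : Columns → Columns
  restrict E = filter (_∈ᶜ? E) (V ²)

  restrict-⊆ : ∀ {E} → restrict E ⊆ E
  restrict-⊆ c∈ = proj₂ (∈-filter⁻ (_∈ᶜ? _) c∈)

  ⊆-restrict : ∀ {E} → E ⊆ V ² → E ⊆ restrict E
  ⊆-restrict E⊆V² c∈E = ∈-filter⁺ (_∈ᶜ? _) (E⊆V² c∈E) c∈E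

  restrict∈sublists : ∀ E → restrict E ∈ sublists (V ²)
  restrict∈sublists E = filter∈sublists (_∈ᶜ? E) (V ²)

  module Finite = FiniteReachability (≡-dec-List _≟ᶜ_) step? (sublists (V ²))
  open Finite using (_⟶_)

  module _ {H : List Columns} (H⊆V² : ∀ {h} → h ∈ H → h ⊆ V ²) where

    reachable⇒restricted : ∀ {E} → Reachable Step H E → Reachable _⟶_ H (restrict (rename retract E))
    reachable⇒restricted = Reachable-simulate (restrict ∘ rename retract) seeds steps
      where
        seeds : ∀ {h} → h ∈ H → Reachable _⟶_ H (restrict (rename retract h))
        seeds {h} h∈H = subst (Reachable _⟶_ H ∘ restrict) (sym (rename-retract-fix (H⊆V² h∈H)))
                          (step (seed h∈H) (extend (⊆-restrict (H⊆V² h∈H)) , restrict∈sublists h))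
        steps : ∀ {D E} → Step D E → Step (restrict (rename retract D)) (restrict (rename retract E))
                                  × restrict (rename retract E) ∈ sublists (V ²)
        steps {D} {E} D→E =
          Step-mono restrict-⊆ (⊆-restrict (rename-retract-⊆² E)) (Step-rename retract D→E)
          , restrict∈sublists (rename retract E)

    reachable? : ∀ {E} → E ⊆ V ² → Dec (Reachable Step H E)
    reachable? {E} E⊆V² = map′ unrestrict restricted (Finite.reachable? H (restrict E))
      where
        unrestrict : Reachable _⟶_ H (restrict E) → Reachable Step H E
        unrestrict r = step (Reachable-simulate id seed proj₁ r) (extend restrict-⊆)
        restricted : Reachable Step H E → Reachable _⟶_ H (restrict E)
        restricted r =
          subst (Reachable _⟶_ H ∘ restrict) (rename-retract-fix E⊆V²) (reachable⇒restricted r)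

-- Soundness of column steps

module Soundness (Γ : List Atom) (r : ℚ) where

  Derives : Tuple × Tuple → Set
  Derives (x , y) = Γ ⊢ (x ∣[ r ] y)

  Holds : Columns → Set
  Holds E = Derives (unzip E)

  private
    infixr 5 _⊕_
    _⊕_ : Tuple × Tuple → Tuple × Tuple → Tuple × Tuple
    _⊕_ = Product.zip _++_ _++_

    lefts rights : Columns → Tuple
    lefts  = proj₁ ∘ unzip
    rights = proj₂ ∘ unzip

    length-unzip : ∀ (E : Columns) → length (lefts E) ≡ length (rights E)
    length-unzip E = trans (length-unzipWith₁ id E) (sym (length-unzipWith₂ id E))

    unzip-++ : ∀ (D E : Columns) → unzip (D ++ E) ≡ unzip D ⊕ unzip E
    unzip-++ = unzipWith-++ id

    unzip-++³ : ∀ (D E F : Columns) → unzip (D ++ E ++ F) ≡ unzip D ⊕ unzip E ⊕ unzip F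
    unzip-++³ D E F = trans (unzip-++ D (E ++ F)) (cong (unzip D ⊕_) (unzip-++ E F))

  Holds-++ : ∀ {D} E → Holds D → Holds (D ++ E)
  Holds-++ {D} E h =
    subst Derives (sym (unzip-++ D E)) (A3 {u = lefts E} {v = rights E} (length-unzip E) h)

  Holds-dedup : ∀ (D E : Columns) → Holds (D ++ E ++ E) → Holds (D ++ E)
  Holds-dedup D E h =
    subst Derives (sym (unzip-++ D E))
      (A4 {x = lefts D} {y = rights D} {u = lefts E} {v = rights E}
          (length-unzip D) (length-unzip E) (subst Derives (unzip-++³ D E E) h))

  Holds-rotate : ∀ (D E F : Columns) → Holds (D ++ E ++ F) → Holds (D ++ F ++ E)
  Holds-rotate D E F h =
    subst Derives (sym (unzip-++³ D F E))
      (A5 {x = lefts D} {y = lefts E} {z = lefts F} {u = rights D} {v = rights E} {w = rights F}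
          (length-unzip D) (length-unzip E) (length-unzip F) (subst Derives (unzip-++³ D E F) h))

  Holds-swap : ∀ {D} → Holds D → Holds (map swap D)
  Holds-swap {D} h = subst Derives (sym (unzip-swap D)) (A2 h)

  -- (A5) moves the second copy of c next to the first, and (A4) merges the two.
  Holds-drop : ∀ {c F} → c ∈ F → Holds (c ∷ F) → Holds F
  Holds-drop {c} c∈F h with ∈-∃++ c∈F
  ... | as , bs , refl = subst Holds (++-assoc as [ c ] bs) (Holds-rotate [] bs (as ++ [ c ]) merged)
    where
      adjacent : Holds ((bs ++ as) ++ c ∷ c ∷ [])
      adjacent = Holds-rotate [] (c ∷ c ∷ []) (bs ++ as) (Holds-rotate [ c ] as (c ∷ bs) h)
      merged : Holds (bs ++ as ++ [ c ])
      merged = subst Holds (++-assoc bs as [ c ]) (Holds-dedup (bs ++ as) [ c ] adjacent)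

  Holds-⊆ : ∀ {D E} → D ⊆ E → Holds D → Holds E
  Holds-⊆ {D} {E} D⊆E h = dropAll D D⊆E (Holds-++ {D} E h)
    where
      dropAll : ∀ D → D ⊆ E → Holds (D ++ E) → Holds E
      dropAll []      _      h = h
      dropAll (c ∷ D) c∷D⊆E h =
        dropAll D (λ c∈D → c∷D⊆E (there c∈D)) (Holds-drop (∈-++⁺ʳ D (c∷D⊆E (here refl))) h)

  -- D sits inside the premise xs ws |_r ys ws of (A6), whose conclusion zs zs |_r xs ys lies in E.
  record Covering (D E : Columns) : Set where
    field
      zs xs ys ws : List Var
      zs≡xs : length zs ≡ length xs
      xs≡ys : length xs ≡ length ys
      D⊆    : D ⊆ zip xs ys ++ zip ws ws
      zsxs⊆E : zip zs xs ⊆ E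
      zsys⊆E : zip zs ys ⊆ E

  covering : ∀ {D E} → All (λ c → Diagonal c ⊎ CoveredBy E c) D → Covering D E
  covering [] = record { zs = [] ; xs = [] ; ys = [] ; ws = [] ; zs≡xs = refl ; xs≡ys = refl
                       ; D⊆ = λ () ; zsxs⊆E = λ () ; zsys⊆E = λ () }
  covering {(a , b) ∷ D} (inj₁ refl ∷ cv) = record
    { zs = zs ; xs = xs ; ys = ys ; ws = a ∷ ws ; zs≡xs = zs≡xs ; xs≡ys = xs≡ys
    ; D⊆ = ∈-∷⁺ʳ (∈-++⁺ʳ (zip xs ys) (here refl)) (λ c∈D → ++⁺ʳ (zip xs ys) (xs⊆x∷xs _ _) (D⊆ c∈D))
    ; zsxs⊆E = zsxs⊆E ; zsys⊆E = zsys⊆E }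
    where open Covering (covering cv)
  covering {(a , b) ∷ D} (inj₂ (z , za∈E , zb∈E) ∷ cv) = record
    { zs = z ∷ zs ; xs = a ∷ xs ; ys = b ∷ ys ; ws = ws
    ; zs≡xs = cong ℕ.suc zs≡xs ; xs≡ys = cong ℕ.suc xs≡ys
    ; D⊆ = ∈-∷⁺ʳ (here refl) (λ c∈D → there (D⊆ c∈D))
    ; zsxs⊆E = ∈-∷⁺ʳ za∈E zsxs⊆E ; zsys⊆E = ∈-∷⁺ʳ zb∈E zsys⊆E }
    where open Covering (covering cv)

  Holds-cover : ∀ {D E} → All (λ c → Diagonal c ⊎ CoveredBy E c) D → Holds D → Holds E
  Holds-cover {D} {E} cv h =
    Holds-⊆ covers⊆E (subst Derives (sym conclusion)
      (A6 {x = xs} {y = ys} {z = zs} {w = ws} xs≡ys zs≡xs (subst Derives premise (Holds-⊆ D⊆ h))))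
    where
      open Covering (covering cv)
      premise : unzip (zip xs ys ++ zip ws ws) ≡ (xs ++ ws , ys ++ ws)
      premise = trans (unzip-++ (zip xs ys) (zip ws ws))
                      (cong₂ _⊕_ (unzip-zip xs ys xs≡ys) (unzip-zip ws ws refl))
      conclusion : unzip (zip zs xs ++ zip zs ys) ≡ (zs ++ zs , xs ++ ys)
      conclusion = trans (unzip-++ (zip zs xs) (zip zs ys))
                         (cong₂ _⊕_ (unzip-zip zs xs zs≡xs) (unzip-zip zs ys (trans zs≡xs xs≡ys)))
      covers⊆E : zip zs xs ++ zip zs ys ⊆ E
      covers⊆E c∈ = Sum.[ zsxs⊆E , zsys⊆E ] (∈-++⁻ (zip zs xs) c∈)

  Holds-step : ∀ {D E} → Step D E → Holds D → Holds E
  Holds-step {D} (flip s) = Holds-⊆ s ∘ Holds-swap {D}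
  Holds-step (extend s)   = Holds-⊆ s
  Holds-step (cover s)    = Holds-cover s

  Holds-reachable : ∀ {H E} → (∀ {h} → h ∈ H → Holds h) → Reachable Step H E → Holds E
  Holds-reachable seeds (seed h∈H)    = seeds h∈H
  Holds-reachable seeds (step r D→E) = Holds-step D→E (Holds-reachable seeds r)

-- Derivations as column reachability

zip-swap : ∀ {A B : Set} (xs : List A) (ys : List B) → map swap (zip xs ys) ⊆ zip ys xs
zip-swap (x ∷ xs) (y ∷ ys) (here refl) = here refl
zip-swap (x ∷ xs) (y ∷ ys) (there c∈)  = there (zip-swap xs ys c∈)

zip-⊆-++ : ∀ {A B : Set} (xs us : List A) (ys vs : List B) → zip xs ys ⊆ zip (xs ++ us) (ys ++ vs)
zip-⊆-++ (x ∷ xs) us (y ∷ ys) vs (here refl) = here refl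
zip-⊆-++ (x ∷ xs) us (y ∷ ys) vs (there c∈)  = there (zip-⊆-++ xs us ys vs c∈)

zip-++ : ∀ {A B : Set} (xs us : List A) (ys vs : List B) → length xs ≡ length ys →
         zip (xs ++ us) (ys ++ vs) ≡ zip xs ys ++ zip us vs
zip-++ []       us []       vs _  = refl
zip-++ (x ∷ xs) us (y ∷ ys) vs eq = cong ((x , y) ∷_) (zip-++ xs us ys vs (suc-injective eq))

zip-diagonal : ∀ (ws : List Var) → All Diagonal (zip ws ws)
zip-diagonal []       = []
zip-diagonal (w ∷ ws) = refl ∷ zip-diagonal ws

zip-covered : ∀ {A B : Set} {zs : List A} {xs ys : List B} → length zs ≡ length xs →
              All (λ c → ∃[ t ] (t , proj₁ c) ∈ zip zs xs × (t , proj₂ c) ∈ zip zs ys) (zip xs ys)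
zip-covered {zs = _}     {[]}     {_}      _  = []
zip-covered {zs = _}     {_ ∷ _}  {[]}     _  = []
zip-covered {zs = z ∷ zs} {_ ∷ xs} {_ ∷ ys} eq =
  (z , here refl , here refl)
  ∷ All.map (λ (t , m₁ , m₂) → t , there m₁ , there m₂) (zip-covered (suc-injective eq))

zip-++³ : ∀ {A B : Set} (xs us ws : List A) (ys vs zs : List B) →
          length xs ≡ length ys → length us ≡ length vs →
          zip (xs ++ us ++ ws) (ys ++ vs ++ zs) ≡ zip xs ys ++ zip us vs ++ zip ws zs
zip-++³ xs us ws ys vs zs xs≡ys us≡vs =
  trans (zip-++ xs (us ++ ws) ys (vs ++ zs) xs≡ys) (cong (zip xs ys ++_) (zip-++ us ws vs zs us≡vs))

A2-step : ∀ x y → Step (zip x y) (zip y x)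
A2-step x y = flip (zip-swap x y)

A3-step : ∀ x y u v → Step (zip x y) (zip (x ++ u) (y ++ v))
A3-step x y u v = extend (zip-⊆-++ x u y v)

A4-step : ∀ {x y u v} → length x ≡ length y → length u ≡ length v →
          Step (zip (x ++ u ++ u) (y ++ v ++ v)) (zip (x ++ u) (y ++ v))
A4-step {x} {y} {u} {v} x≡y u≡v
  rewrite zip-++³ x u u y v v x≡y u≡v | zip-++ x u y v x≡y =
  extend (++⁺ʳ (zip x y) (λ c∈ → Sum.[ id , id ] (∈-++⁻ (zip u v) c∈)))

A5-step : ∀ {x y z u v w} → length x ≡ length u → length y ≡ length v → length z ≡ length w →
          Step (zip (x ++ y ++ z) (u ++ v ++ w)) (zip (x ++ z ++ y) (u ++ w ++ v))
A5-step {x} {y} {z} {u} {v} {w} x≡u y≡v z≡w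
  rewrite zip-++³ x y z u v w x≡u y≡v | zip-++³ x z y u w v x≡u z≡w =
  extend (++⁺ʳ (zip x u) (⊆-reflexive-↭ (++-comm (zip y v) (zip z w))))

A6-step : ∀ {x y z w} → length x ≡ length y → length z ≡ length x →
          Step (zip (x ++ w) (y ++ w)) (zip (z ++ z) (x ++ y))
A6-step {x} {y} {z} {w} x≡y z≡x
  rewrite zip-++ x w y w x≡y | zip-++ z z x y z≡x =
  cover (All.++⁺ (All.map (inj₂ ∘ joined) (zip-covered z≡x)) (All.map inj₁ (zip-diagonal w)))
  where
    joined : ∀ {c} → ∃[ t ] (t , proj₁ c) ∈ zip z x × (t , proj₂ c) ∈ zip z y →
             CoveredBy (zip z x ++ zip z y) c
    joined (t , m₁ , m₂) = t , ∈-++⁺ˡ m₁ , ∈-++⁺ʳ (zip z x) m₂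

module Completeness (Γ : List Atom) where

  open import Data.List.Extrema (DecTotalOrder.totalOrder ℚ.≤-decTotalOrder)
    using (max; argmax-sel; xs≤max)

  seeds : ℚ → List Columns
  seeds q = map columns (filter (λ φ → prob φ ℚ.≤? q) Γ)

  columns∈seeds : ∀ {φ q} → φ ∈ Γ → prob φ ≤ q → columns φ ∈ seeds q
  columns∈seeds φ∈Γ φ≤q = ∈-map⁺ columns (∈-filter⁺ (λ φ → prob φ ℚ.≤? _) φ∈Γ φ≤q)

  ∈seeds : ∀ {h q} → h ∈ seeds q → ∃[ φ ] φ ∈ Γ × prob φ ≤ q × h ≡ columns φ
  ∈seeds {q = q} h∈ with ∈-map⁻ columns h∈
  ... | φ , φ∈ , refl = φ , Product.map₂ (_, refl) (∈-filter⁻ (λ φ → prob φ ℚ.≤? q) φ∈)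

  seeds-mono : ∀ {q q′} → (∀ {φ} → φ ∈ Γ → prob φ ≤ q → prob φ ≤ q′) → seeds q ⊆ seeds q′
  seeds-mono raise h∈ with ∈seeds h∈
  ... | φ , φ∈Γ , φ≤q , refl = columns∈seeds φ∈Γ (raise φ∈Γ φ≤q)

  Reachable-raise : ∀ {q q′ E} → (∀ {φ} → φ ∈ Γ → prob φ ≤ q → prob φ ≤ q′) →
                    Reachable Step (seeds q) E → Reachable Step (seeds q′) E
  Reachable-raise raise = Reachable-simulate id (seed ∘ seeds-mono raise) id

  probs<1 : List ℚ
  probs<1 = filter (ℚ._<? 1ℚ) (map prob Γ)

  -- a single level below 1 at which, by (A7), every hypothesis of probability below 1 holds
  pmax : ℚ
  pmax = max 0ℚ probs<1

  pmax<1 : pmax < 1ℚ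
  pmax<1 with argmax-sel id 0ℚ probs<1
  ... | inj₁ pmax≡0 = subst (_< 1ℚ) (sym pmax≡0) (ℚ.positive⁻¹ 1ℚ)
  ... | inj₂ pmax∈  = proj₂ (∈-filter⁻ (ℚ._<? 1ℚ) {xs = map prob Γ} pmax∈)

  ≤pmax : ∀ {φ} → φ ∈ Γ → prob φ < 1ℚ → prob φ ≤ pmax
  ≤pmax φ∈Γ φ<1 = All.lookup (xs≤max 0ℚ probs<1) (∈-filter⁺ (ℚ._<? 1ℚ) (∈-map⁺ prob φ∈Γ) φ<1)

  Inconsistent : Set
  Inconsistent = Reachable Step (seeds pmax) []

  Outcome : Atom → Set
  Outcome φ = Inconsistent ⊎ 1ℚ ≤ prob φ ⊎ Reachable Step (seeds (prob φ)) (columns φ)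

  stepping : ∀ {x y u v p} → Step (zip x y) (zip u v) → Outcome (x ∣[ p ] y) → Outcome (u ∣[ p ] v)
  stepping s = Sum.map₂ (Sum.map₂ (λ r → step r s))

  ⊢⇒outcome : ∀ {φ} → Γ ⊢ φ → Outcome φ
  ⊢⇒outcome (hyp φ∈Γ) = inj₂ (inj₂ (seed (columns∈seeds φ∈Γ ℚ.≤-refl)))
  ⊢⇒outcome (A1 {x} p<1 _ d) with ⊢⇒outcome d
  ... | inj₁ inconsistent = inj₁ inconsistent
  ... | inj₂ (inj₁ 1≤p)   = contradiction (ℚ.≤-<-trans 1≤p p<1) (ℚ.<-irrefl refl)
  ... | inj₂ (inj₂ x∣x)   =
    inj₁ (step (Reachable-raise (λ φ∈Γ φ≤p → ≤pmax φ∈Γ (ℚ.≤-<-trans φ≤p p<1)) x∣x)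
               (cover (All.map inj₁ (zip-diagonal x))))
  ⊢⇒outcome (A2 {x} {y} d)                  = stepping (A2-step x y) (⊢⇒outcome d)
  ⊢⇒outcome (A3 {x} {y} {u} {v} _ d)        = stepping (A3-step x y u v) (⊢⇒outcome d)
  ⊢⇒outcome (A4 {x} {y} {u} {v} x≡y u≡v d) = stepping (A4-step {x} {y} {u} {v} x≡y u≡v) (⊢⇒outcome d)
  ⊢⇒outcome (A5 {x} {y} {z} {u} {v} {w} x≡u y≡v z≡w d) =
    stepping (A5-step {x} {y} {z} {u} {v} {w} x≡u y≡v z≡w) (⊢⇒outcome d)
  ⊢⇒outcome (A6 {x} {y} {z} {w} x≡y z≡x d) = stepping (A6-step {x} {y} {z} {w} x≡y z≡x) (⊢⇒outcome d)
  ⊢⇒outcome (A7 q≤p _ d) with ⊢⇒outcome d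
  ... | inj₁ inconsistent = inj₁ inconsistent
  ... | inj₂ (inj₁ 1≤q)   = inj₂ (inj₁ (ℚ.≤-trans 1≤q q≤p))
  ... | inj₂ (inj₂ x∣y)   =
    inj₂ (inj₂ (Reachable-raise (λ _ φ≤q → ℚ.≤-trans φ≤q q≤p) x∣y))
  ⊢⇒outcome (A8 _) = inj₂ (inj₁ ℚ.≤-refl)

zip-⊆² : ∀ {V xs ys} → xs ⊆ V → ys ⊆ V → zip xs ys ⊆ V ²
zip-⊆² {xs = x ∷ xs} {y ∷ ys} xs⊆V ys⊆V (here refl) =
  ∈-cartesianProduct⁺ (xs⊆V (here refl)) (ys⊆V (here refl))
zip-⊆² {xs = x ∷ xs} {y ∷ ys} xs⊆V ys⊆V (there c∈)  = zip-⊆² (xs⊆V ∘ there) (ys⊆V ∘ there) c∈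

vars : List Atom → List Var
vars = concatMap (λ φ → lhs φ ++ rhs φ)

columns-⊆² : ∀ {φ} v₀ Φ → φ ∈ Φ → columns φ ⊆ (v₀ ∷ vars Φ) ²
columns-⊆² {φ} v₀ Φ φ∈Φ = zip-⊆² (there ∘ in-vars ∘ ∈-++⁺ˡ) (there ∘ in-vars ∘ ∈-++⁺ʳ (lhs φ))
  where
    in-vars : ∀ {v} → v ∈ lhs φ ++ rhs φ → v ∈ vars Φ
    in-vars v∈ = ∈-concatMap⁺ (λ φ → lhs φ ++ rhs φ) (lose φ∈Φ v∈)

module _ (Γ : List Atom) (wf : All WellFormed Γ) where

  open Completeness Γ
  open Soundness Γ using (Derives; Holds; Holds-reachable)

  seeds-hold : ∀ {q h} → q ≤ 1ℚ → h ∈ seeds q → Holds q h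
  seeds-hold q≤1 h∈ with ∈seeds h∈
  ... | φ , φ∈Γ , φ≤q , refl =
    subst (Derives _) (sym (unzip-zip (lhs φ) (rhs φ) (proj₁ (All.lookup wf φ∈Γ))))
      (A7 φ≤q q≤1 (hyp φ∈Γ))

  reachable⇔⊢ : ∀ {x y p} → length x ≡ length y → 0ℚ ≤ p → p < 1ℚ →
                (Inconsistent ⊎ Reachable Step (seeds p) (zip x y)) ⇔ Γ ⊢ (x ∣[ p ] y)
  reachable⇔⊢ {x} {y} {p} x≡y 0≤p p<1 = mk⇔ sound complete
    where
      complete : Γ ⊢ (x ∣[ p ] y) → Inconsistent ⊎ Reachable Step (seeds p) (zip x y)
      complete d with ⊢⇒outcome d
      ... | inj₁ inconsistent = inj₁ inconsistent
      ... | inj₂ (inj₁ 1≤p)   = contradiction (ℚ.≤-<-trans 1≤p p<1) (ℚ.<-irrefl refl)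
      ... | inj₂ (inj₂ x∣y)   = inj₂ x∣y
      sound : Inconsistent ⊎ Reachable Step (seeds p) (zip x y) → Γ ⊢ (x ∣[ p ] y)
      sound (inj₁ inconsistent) = A7 0≤p (ℚ.<⇒≤ p<1) (A1 {x = []} pmax<1 x≡y empty)
        where
          empty : Γ ⊢ ([] ∣[ pmax ] [])
          empty = Holds-reachable pmax (seeds-hold (ℚ.<⇒≤ pmax<1)) inconsistent
      sound (inj₂ x∣y) =
        subst (Derives p) (unzip-zip x y x≡y) (Holds-reachable p (seeds-hold (ℚ.<⇒≤ p<1)) x∣y)

  ⊢-dec : ∀ x y p → length x ≡ length y → 0ℚ ≤ p → p < 1ℚ → Dec (Γ ⊢ (x ∣[ p ] y))
  ⊢-dec x y p x≡y 0≤p p<1 =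
    Dec.map (reachable⇔⊢ x≡y 0≤p p<1)
            (reachable? (seeds⊆V² {pmax}) (λ ())
             ⊎-dec reachable? (seeds⊆V² {p}) (columns-⊆² 0 Φ (here refl)))
    where
      Φ : List Atom
      Φ = (x ∣[ p ] y) ∷ Γ
      open ColumnReachability 0 (vars Φ)
      seeds⊆V² : ∀ {q h} → h ∈ seeds q → h ⊆ V ²
      seeds⊆V² h∈ with ∈seeds h∈
      ... | φ , φ∈Γ , _ , refl = columns-⊆² 0 Φ (there φ∈Γ)

theorem4 : (Σ : List Atom) → All WellFormed Σ →
           (x y : Tuple) (p : ℚ) → length x ≡ length y → 0ℚ ≤ p → p < ½ →
           Dec (Σ ⊢ (x ∣[ p ] y))
theorem4 Σ wf x y p x≡y 0≤p p<½ = ⊢-dec Σ wf x y p x≡y 0≤p (ℚ.<-trans p<½ (from-yes (½ ℚ.<? 1ℚ)))
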